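{- Let $G$ be a finite simple graph, let $S\subseteq V(G)$, and let $K_1,\dots,K_s$ be the distinct non-empty independent subsets of the induced subgraph $G[S]$. (1) The sets $\mathcal{P}^c_{K_1}(G),\dots,\mathcal{P}^c_{K_s}(G)$ are pairwise disjoint and their union equals $\mathcal{P}_S(G)$; that is, the identity maps induce a bijection $\mathcal{P}^c_{K_1}(G)\sqcup\cdots\sqcup\mathcal{P}^c_{K_s}(G)\to\mathcal{P}_S(G)$. (2) For every non-empty independent subset $K\subseteq S$, the map $\varphi_K:\mathcal{P}^c_K(G)\to\mathcal{P}^{\emptyset}_{N_G[K]}(G)$, $\mathbf{w}\mapsto \mathbf{w}/\prod_{y\in K}y$, is well defined and bijective.
   Context: $\mathcal{P}^{\emptyset}(G)$ denotes the partially commutative monoid of $G$: generated by $V(G)$ subject only to $ab=ba$ for distinct non-adjacent $a,b\in V(G)$; its elements are words, the identity is the empty word, and $\mathcal{P}(G)$ is the set of non-empty words. The initial alphabet $\mathrm{IA}(\mathbf{w})$ of a non-empty word $\mathbf{w}$ is the set of $v\in V(G)$ with $\mathbf{w}=\mathbf{u}v$ for some $\mathbf{u}\in\mathcal{P}^{\emptyset}(G)$. For $S\subseteq V(G)$: $\mathcal{P}_S(G)=\{\mathbf{w}\in\mathcal{P}(G):\mathrm{IA}(\mathbf{w})\subseteq S\}$, $\mathcal{P}^{\emptyset}_S(G)=\mathcal{P}_S(G)\cup\{\text{empty word}\}$, and $\mathcal{P}^c_S(G)=\{\mathbf{w}\in\mathcal{P}(G):\mathrm{IA}(\mathbf{w})=S\}$.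 A subset is independent if no two of its elements are adjacent. For $K\subseteq V(G)$, $N_G[K]=\bigcup_{y\in K}(N_G(y)\cup\{y\})$ is the closed neighbourhood. For $\mathbf{w}\in\mathcal{P}^c_K(G)$ with $K$ independent, $\mathbf{w}/\prod_{y\in K}y$ denotes the unique word $\mathbf{w}'\in\mathcal{P}^{\emptyset}(G)$ with $\mathbf{w}=\mathbf{w}'\prod_{y\in K}y$ (the product order is irrelevant since $K$ is independent). -}

module Defs where

open import Data.Nat using (ℕ)
open import Data.Fin using (Fin; zero; suc)
open import Data.Fin.Subset using (Subset; _∈_; _⊆_; Nonempty)
open import Data.Bool using (true; false)
open import Data.Vec using ([]; _∷_)
open import Data.List using (List; []; _∷_; _++_; [_]; map)
open import Data.Product using (Σ; _×_; ∃; _,_)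
open import Data.Sum using (_⊎_)
open import Relation.Nullary using (¬_)
open import Relation.Binary using (Decidable)
open import Relation.Binary.PropositionalEquality using (_≡_; _≢_)
open import Relation.Binary.Construct.Closure.Equivalence using (EqClosure)
open import Function.Bundles using (_⇔_)

record Graph (n : ℕ) : Set₁ where
  field
    Adj     : Fin n → Fin n → Set
    adj?    : Decidable Adj
    sym     : ∀ {a b} → Adj a b → Adj b a
    irrefl  : ∀ {a} → ¬ Adj a a
open Graph public

module _ {n : ℕ} (G : Graph n) where

  Word : Set
  Word = List (Fin n)

  data Swap : Word → Word → Set where
    swap : ∀ (u v : Word) (a b : Fin n) → a ≢ b → ¬ Adj G a b →
           Swap (u ++ a ∷ b ∷ v) (u ++ b ∷ a ∷ v)

  -- Equality in the partially commutative monoid P^∅(G):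
  -- the congruence generated by the commutations (a setoid on lists).
  _≈w_ : Word → Word → Set
  _≈w_ = EqClosure Swap

  IA : Word → Fin n → Set
  IA w v = Σ Word λ u → w ≈w (u ++ [ v ])

  NonEmptyWord : Word → Set
  NonEmptyWord w = w ≢ []

  P_ : Subset n → Word → Set
  P_ S w = NonEmptyWord w × (∀ v → IA w v → v ∈ S)

  P∅_ : Subset n → Word → Set
  P∅_ S w = (w ≡ []) ⊎ P_ S w

  Pc_ : Subset n → Word → Set
  Pc_ S w = NonEmptyWord w × (∀ v → IA w v ⇔ v ∈ S)

  Independent : Subset n → Set
  Independent K = ∀ a b → a ∈ K → b ∈ K → ¬ Adj G a b

  N[_] : Subset n → Fin n → Set
  N[_] K v = Σ (Fin n) λ y → y ∈ K × (v ≡ y ⊎ Adj G v y)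

  P∅Pred : (Fin n → Set) → Word → Set
  P∅Pred T w = (w ≡ []) ⊎ (NonEmptyWord w × (∀ v → IA w v → T v))

-- The elements of a subset listed in increasing order; used for the word ∏_{y∈K} y.
elems : ∀ {n} → Subset n → List (Fin n)
elems []          = []
elems (true  ∷ p) = zero ∷ map suc (elems p)
elems (false ∷ p) = map suc (elems p)

-- Reading a word from the right for a letter v, and stopping at the first v or at the first
-- neighbour of v, decides whether v ∈ IA(w) and yields w with that v deleted; the outcome is
-- invariant under commutations. Hence IA(w) is decidable and independent, words cancel on the
-- right, and a word whose initial alphabet contains a pairwise commuting list L factors as w′ L.
-- So the classes IA(w) = K partition P_S(G), and w′ ↦ w′ ∏K inverts w ↦ w / ∏K: the condition
-- IA(w′) ⊆ N[K] says exactly that no letter of w′ can be moved past ∏K to the end.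
module Submission where

open import Defs hiding (sym)
open import Data.Nat using (ℕ)
open import Data.Fin using (Fin; suc; _≟_)
open import Data.Fin.Properties using (suc-injective)
open import Data.Fin.Subset using (Subset; _∈_; _⊆_; Nonempty)
open import Data.Fin.Subset.Properties using (⊆-antisym)
open import Data.Bool using (true; false)
open import Data.Bool.Properties using (T-≡)
open import Data.Vec using (tabulate; here; there) renaming ([] to []ᵥ; _∷_ to _∷ᵥ_)
open import Data.Vec.Properties using (lookup∘tabulate; []=⇒lookup; lookup⇒[]=)
open import Data.List using (List; []; _∷_; _++_; [_]; initLast; _∷ʳ′_)
open import Data.List.Properties using (++-assoc; ++-identityʳ; ++-conicalʳ)
open import Data.List.Membership.Propositional using (find) renaming (_∈_ to _∈ₗ_)
open import Data.List.Membership.Propositional.Properties using (∈-map⁺; ∈-map⁻)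
open import Data.List.Relation.Unary.All as All using (All; []; _∷_)
open import Data.List.Relation.Unary.All.Properties using (¬Any⇒All¬)
import Data.List.Relation.Unary.All.Properties as All
open import Data.List.Relation.Unary.Any using (here; there; any?)
open import Data.List.Relation.Unary.AllPairs using (AllPairs; []; _∷_)
open import Data.List.Relation.Unary.Unique.Propositional using (Unique)
import Data.List.Relation.Unary.Unique.Propositional.Properties as Unique
open import Data.Product using (Σ; ∃; _×_; _,_; proj₁; proj₂)
open import Data.Sum using (_⊎_; inj₁; inj₂)
open import Data.Empty using (⊥-elim)
open import Function using (_∘_)
open import Function.Bundles using (_⇔_; mk⇔; Equivalence)
import Function.Properties.Equivalence as ⇔
open import Relation.Nullary using (¬_; yes; no)
open import Relation.Nullary.Decidable using (Dec; isYes; _⊎-dec_; toWitness; fromWitness)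
import Relation.Nullary.Decidable as Dec
open import Relation.Unary using (Decidable)
open import Relation.Binary using (Setoid; IsEquivalence)
import Relation.Binary.Reasoning.Setoid as ≈-Reasoning
open import Relation.Binary.PropositionalEquality as ≡ using (_≡_; _≢_; refl; subst₂)
import Relation.Binary.Construct.Closure.Equivalence as EqClosure

open Equivalence using (to; from)

module _ {n : ℕ} where

  decSubset : {Q : Fin n → Set} → Decidable Q → Subset n
  decSubset Q? = tabulate (isYes ∘ Q?)

  ∈-decSubset : {Q : Fin n → Set} (Q? : Decidable Q) {x : Fin n} → x ∈ decSubset Q? ⇔ Q x
  ∈-decSubset Q? {x} = mk⇔
    (λ x∈ → toWitness {a? = Q? x} (from T-≡ (≡.trans (≡.sym (lookup∘tabulate _ x)) ([]=⇒lookup x∈))))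
    (λ qx → lookup⇒[]= x _ (≡.trans (lookup∘tabulate _ x) (to T-≡ (fromWitness {a? = Q? x} qx))))

∈-elems : ∀ {n} {K : Subset n} {x} → x ∈ₗ elems K ⇔ x ∈ K
∈-elems = mk⇔ (elems⊆ _) (⊆elems _)
  where
  elems⊆ : ∀ {n} (K : Subset n) {x} → x ∈ₗ elems K → x ∈ K
  elems⊆ (true ∷ᵥ K) (here refl) = here
  elems⊆ (true ∷ᵥ K) (there x∈) with ∈-map⁻ suc x∈
  ... | _ , y∈ , refl = there (elems⊆ K y∈)
  elems⊆ (false ∷ᵥ K) x∈ with ∈-map⁻ suc x∈
  ... | _ , y∈ , refl = there (elems⊆ K y∈)
  ⊆elems : ∀ {n} (K : Subset n) {x} → x ∈ K → x ∈ₗ elems K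
  ⊆elems (true ∷ᵥ K) here = here refl
  ⊆elems (true ∷ᵥ K) (there x∈) = there (∈-map⁺ suc (⊆elems K x∈))
  ⊆elems (false ∷ᵥ K) (there x∈) = ∈-map⁺ suc (⊆elems K x∈)

elems-unique : ∀ {n} (K : Subset n) → Unique (elems K)
elems-unique []ᵥ = []
elems-unique (true ∷ᵥ K) =
  All.map⁺ (All.universal (λ _ ()) (elems K)) ∷ Unique.map⁺ suc-injective (elems-unique K)
elems-unique (false ∷ᵥ K) = Unique.map⁺ suc-injective (elems-unique K)

unique⇒allPairs : ∀ {A : Set} {R : A → A → Set} {L : List A} →
  (∀ {a b} → a ∈ₗ L → b ∈ₗ L → a ≢ b → R a b) → Unique L → AllPairs R L
unique⇒allPairs f [] = []
unique⇒allPairs f (x∉L ∷ !L) =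
  All.tabulate (λ b∈ → f (here refl) (there b∈) (All.lookup x∉L b∈))
  ∷ unique⇒allPairs (λ a∈ b∈ → f (there a∈) (there b∈)) !L

-- The partially commutative monoid

module _ {n : ℕ} (G : Graph n) where

  infix 4 _≈_
  _≈_ : Word G → Word G → Set
  _≈_ = _≈w_ G

  ≈-setoid : Setoid _ _
  ≈-setoid = EqClosure.setoid (Swap G)

  open Setoid ≈-setoid public using ()
    renaming (refl to ≈-refl; sym to ≈-sym; trans to ≈-trans; reflexive to ≈-reflexive)

  Commute : Fin n → Fin n → Set
  Commute a b = a ≢ b × ¬ Adj G a b

  swap-≈ : ∀ u t {a b} → Commute a b → u ++ a ∷ b ∷ t ≈ u ++ b ∷ a ∷ t
  swap-≈ u t {a} {b} (a≢b , a≁b) = EqClosure.return (swap u t a b a≢b a≁b)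

  ≈-++ˡ : ∀ u {w w′} → w ≈ w′ → u ++ w ≈ u ++ w′
  ≈-++ˡ u = EqClosure.gmap (u ++_) λ where
    (swap u′ t a b a≢b a≁b) →
      subst₂ (Swap G) (++-assoc u u′ _) (++-assoc u u′ _) (swap (u ++ u′) t a b a≢b a≁b)

  ≈-++ʳ : ∀ t {w w′} → w ≈ w′ → w ++ t ≈ w′ ++ t
  ≈-++ʳ t = EqClosure.gmap (_++ t) λ where
    (swap u v a b a≢b a≁b) →
      subst₂ (Swap G) (≡.sym (++-assoc u _ t)) (≡.sym (++-assoc u _ t)) (swap u (v ++ t) a b a≢b a≁b)

  commute-past : ∀ {v} w → All (Commute v) w → v ∷ w ≈ w ++ [ v ]
  commute-past [] [] = ≈-refl
  commute-past (x ∷ w) (vx ∷ vw) = ≈-trans (swap-≈ [] w vx) (≈-++ˡ [ x ] (commute-past w vw))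

  data Contact (v x : Fin n) : Set where
    equal     : v ≡ x → Contact v x
    commuting : Commute v x → Contact v x
    blocking  : Adj G v x → Contact v x

  contact : ∀ v x → Contact v x
  contact v x with v ≟ x
  ... | yes v≡x = equal v≡x
  ... | no v≢x with adj? G v x
  ...   | yes v~x = blocking v~x
  ...   | no v≁x = commuting (v≢x , v≁x)

  -- scan v w reads w from the right: it stays clear while the letters commute with v,
  -- is found r at the first v (r being w with that v deleted), and blocked at a neighbour of v.
  data Scan : Set where
    clear   : Scan
    found   : Word G → Scan
    blocked : Scan

  mapFound : (Word G → Word G) → Scan → Scan
  mapFound f clear = clear
  mapFound f (found r) = found (f r)
  mapFound f blocked = blocked

  infix 4 _≋_
  data _≋_ : Scan → Scan → Set where
    clear   : clear ≋ clear
    found   : ∀ {r r′} → r ≈ r′ → found r ≋ found r′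
    blocked : blocked ≋ blocked

  ≋-isEquivalence : IsEquivalence _≋_
  ≋-isEquivalence = record { refl = ≋-refl ; sym = ≋-sym ; trans = ≋-trans }
    where
    ≋-refl : ∀ {s} → s ≋ s
    ≋-refl {clear} = clear
    ≋-refl {found _} = found ≈-refl
    ≋-refl {blocked} = blocked
    ≋-sym : ∀ {s s′} → s ≋ s′ → s′ ≋ s
    ≋-sym clear = clear
    ≋-sym (found r≈) = found (≈-sym r≈)
    ≋-sym blocked = blocked
    ≋-trans : ∀ {s s′ s″} → s ≋ s′ → s′ ≋ s″ → s ≋ s″
    ≋-trans clear clear = clear
    ≋-trans (found r≈) (found r≈′) = found (≈-trans r≈ r≈′)
    ≋-trans blocked blocked = blocked

  ≋-found : ∀ {s r} → s ≋ found r → ∃ λ r′ → s ≡ found r′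
  ≋-found (found _) = _ , refl

  module _ (v : Fin n) where

    settle : ∀ {x} → Contact v x → Word G → Scan
    settle (equal _) w = found w
    settle (commuting _) w = clear
    settle (blocking _) w = blocked

    extend : Fin n → Word G → Scan → Scan
    extend x w clear = settle (contact v x) w
    extend x w (found r) = found (x ∷ r)
    extend x w blocked = blocked

    scan : Word G → Scan
    scan [] = clear
    scan (x ∷ w) = extend x w (scan w)

    settle-contact : ∀ {x} (c : Contact v x) w → settle (contact v x) w ≡ settle c w
    settle-contact {x} c w with contact v x | c
    ... | equal _ | equal _ = refl
    ... | commuting _ | commuting _ = refl
    ... | blocking _ | blocking _ = refl
    ... | equal refl | commuting (v≢v , _) = ⊥-elim (v≢v refl)
    ... | equal refl | blocking v~v = ⊥-elim (irrefl G v~v)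
    ... | commuting (v≢v , _) | equal refl = ⊥-elim (v≢v refl)
    ... | commuting (_ , v≁x) | blocking v~x = ⊥-elim (v≁x v~x)
    ... | blocking v~v | equal refl = ⊥-elim (irrefl G v~v)
    ... | blocking v~x | commuting (_ , v≁x) = ⊥-elim (v≁x v~x)

    extend-cong : ∀ x {w w′ s s′} → w ≈ w′ → s ≋ s′ → extend x w s ≋ extend x w′ s′
    extend-cong x w≈ clear with contact v x
    ... | equal _ = found w≈
    ... | commuting _ = clear
    ... | blocking _ = blocked
    extend-cong x w≈ (found r≈) = found (≈-++ˡ [ x ] r≈)
    extend-cong x w≈ blocked = blocked

    extend-commute : ∀ {a b} t → Commute a b → ∀ s →
      extend a (b ∷ t) (extend b t s) ≋ extend b (a ∷ t) (extend a t s)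
    extend-commute {a} {b} t ab clear with contact v a | contact v b
    ... | equal refl | equal refl = ⊥-elim (proj₁ ab refl)
    ... | equal refl | commuting _ rewrite settle-contact (equal refl) (b ∷ t) = found ≈-refl
    ... | equal refl | blocking v~b = ⊥-elim (proj₂ ab v~b)
    ... | commuting _ | equal refl rewrite settle-contact (equal refl) (a ∷ t) = found ≈-refl
    ... | commuting va | commuting vb
      rewrite settle-contact (commuting va) (b ∷ t) | settle-contact (commuting vb) (a ∷ t) = clear
    ... | commuting _ | blocking v~b rewrite settle-contact (blocking v~b) (a ∷ t) = blocked
    ... | blocking v~a | equal refl = ⊥-elim (proj₂ ab (Graph.sym G v~a))
    ... | blocking v~a | commuting _ rewrite settle-contact (blocking v~a) (b ∷ t) = blocked
    ... | blocking _ | blocking _ = blocked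
    extend-commute t ab (found r) = found (swap-≈ [] r ab)
    extend-commute t ab blocked = blocked

    scan-swap : ∀ u t {a b} → Commute a b → scan (u ++ a ∷ b ∷ t) ≋ scan (u ++ b ∷ a ∷ t)
    scan-swap [] t ab = extend-commute t ab (scan t)
    scan-swap (x ∷ u) t ab = extend-cong x (swap-≈ u t ab) (scan-swap u t ab)

    scan-≈ : ∀ {w w′} → w ≈ w′ → scan w ≋ scan w′
    scan-≈ = EqClosure.gfold ≋-isEquivalence scan λ where
      (swap u t a b a≢b a≁b) → scan-swap u t (a≢b , a≁b)

    scan-++-found : ∀ u {t r} → scan t ≡ found r → scan (u ++ t) ≡ found (u ++ r)
    scan-++-found [] t≡ = t≡
    scan-++-found (x ∷ u) {t} t≡ rewrite scan-++-found u {t} t≡ = refl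

    scan-++-blocked : ∀ u {t} → scan t ≡ blocked → scan (u ++ t) ≡ blocked
    scan-++-blocked [] t≡ = t≡
    scan-++-blocked (x ∷ u) {t} t≡ rewrite scan-++-blocked u {t} t≡ = refl

    scan-++-clear : ∀ u {t} → scan t ≡ clear → scan (u ++ t) ≡ mapFound (_++ t) (scan u)
    scan-++-clear [] t≡ = t≡
    scan-++-clear (x ∷ u) {t} t≡ rewrite scan-++-clear u {t} t≡ with scan u
    ... | found _ = refl
    ... | blocked = refl
    ... | clear with contact v x
    ...   | equal _ = refl
    ...   | commuting _ = refl
    ...   | blocking _ = refl

    scan-snoc : ∀ u → scan (u ++ [ v ]) ≡ found u
    scan-snoc u = ≡.trans (scan-++-found u (settle-contact (equal refl) [])) (≡.cong found (++-identityʳ u))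

    scan-clear : ∀ w → scan w ≡ clear → All (Commute v) w
    scan-clear [] _ = []
    scan-clear (x ∷ w) e with scan w in eq
    ... | clear with contact v x | e
    ...   | commuting vx | _ = vx ∷ scan-clear w eq
    scan-clear (x ∷ w) () | found _
    scan-clear (x ∷ w) () | blocked

    scan-found : ∀ w {r} → scan w ≡ found r → w ≈ r ++ [ v ]
    scan-found (x ∷ w) e with scan w in eq
    ... | found _ with e
    ...   | refl = ≈-++ˡ [ x ] (scan-found w eq)
    scan-found (x ∷ w) e | clear with contact v x | e
    ...   | equal refl | refl = commute-past w (scan-clear w eq)

    scan-found-∈ : ∀ w {r} → scan w ≡ found r → v ∈ₗ w
    scan-found-∈ (x ∷ w) e with scan w in eq
    ... | found _ = there (scan-found-∈ w eq)
    ... | clear with contact v x | e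
    ...   | equal refl | _ = here refl

  -- Initial alphabets

  IA⇒found : ∀ {w v} → IA G w v → ∃ λ r → scan v w ≡ found r
  IA⇒found {w} {v} (u , w≈) = ≋-found (≡.subst (scan v w ≋_) (scan-snoc v u) (scan-≈ v w≈))

  IA-resp-≈ : ∀ {w w′ v} → w ≈ w′ → IA G w′ v → IA G w v
  IA-resp-≈ w≈ (u , w′≈) = u , ≈-trans w≈ w′≈

  found⇔IA : ∀ {w v} → (∃ λ r → scan v w ≡ found r) ⇔ IA G w v
  found⇔IA {w} {v} = mk⇔ (λ (r , e) → r , scan-found v w e) IA⇒found

  IA? : ∀ w v → Dec (IA G w v)
  IA? w v = Dec.map found⇔IA (isFound? (scan v w))
    where
    isFound? : ∀ s → Dec (∃ λ r → s ≡ found r)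
    isFound? clear = no λ { (_ , ()) }
    isFound? (found r) = yes (r , refl)
    isFound? blocked = no λ { (_ , ()) }

  IA⇒∈ : ∀ {w v} → IA G w v → v ∈ₗ w
  IA⇒∈ {w} {v} ia = let r , e = IA⇒found ia in scan-found-∈ v w e

  IA-nonempty : ∀ {w} → NonEmptyWord G w → ∃ (IA G w)
  IA-nonempty {w} w≢[] with initLast w
  ... | [] = ⊥-elim (w≢[] refl)
  ... | u ∷ʳ′ v = v , u , ≈-refl

  IA-independent : ∀ {w a b} → IA G w a → IA G w b → ¬ Adj G a b
  IA-independent {w} {a} {b} (r , w≈) ia a~b with IA⇒found ia
  ... | r′ , e = found≉blocked (≡.subst₂ _≋_ e (scan-++-blocked b r blocked-at-a) (scan-≈ b w≈))
    where
    blocked-at-a : scan b [ a ] ≡ blocked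
    blocked-at-a = settle-contact b (blocking (Graph.sym G a~b)) []
    found≉blocked : ∀ {r} → ¬ found r ≋ blocked
    found≉blocked ()

  IA-++ˡ : ∀ u {t v} → IA G t v → IA G (u ++ t) v
  IA-++ˡ u {v = v} (r , t≈) = u ++ r , ≈-trans (≈-++ˡ u t≈) (≈-reflexive (≡.sym (++-assoc u r [ v ])))

  IA-++-commuting : ∀ {u t v} → IA G u v → All (Commute v) t → IA G (u ++ t) v
  IA-++-commuting {u} {t} {v} (r , u≈) vt = r ++ t , u++t≈
    where
    open ≈-Reasoning ≈-setoid
    u++t≈ : u ++ t ≈ (r ++ t) ++ [ v ]
    u++t≈ = begin
      u ++ t             ≈⟨ ≈-++ʳ t u≈ ⟩
      (r ++ [ v ]) ++ t  ≡⟨ ++-assoc r [ v ] t ⟩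
      r ++ v ∷ t         ≈⟨ ≈-++ˡ r (commute-past t vt) ⟩
      r ++ t ++ [ v ]    ≡⟨ ++-assoc r t [ v ] ⟨
      (r ++ t) ++ [ v ]  ∎

  IA-++⁻ : ∀ u {t v} → IA G (u ++ t) v → IA G t v ⊎ (IA G u v × All (Commute v) t)
  IA-++⁻ u {t} {v} ia with scan v t in eq
  ... | found q = inj₁ (q , scan-found v t eq)
  ... | blocked = ⊥-elim (found≢blocked (≡.trans (≡.sym (proj₂ (IA⇒found ia))) (scan-++-blocked v u eq)))
    where
    found≢blocked : ∀ {r} → _≢_ {A = Scan} (found r) blocked
    found≢blocked ()
  ... | clear with scan v u in equ | ≡.trans (≡.sym (proj₂ (IA⇒found ia))) (scan-++-clear v u eq)
  ...   | found r | _ = inj₂ ((r , scan-found v u equ) , scan-clear v t eq)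

  IA-commuting : ∀ {L y} → AllPairs Commute L → y ∈ₗ L → IA G L y
  IA-commuting {x ∷ L} (xL ∷ _) (here refl) = L , commute-past L xL
  IA-commuting {x ∷ L} (_ ∷ !L) (there y∈) = IA-++ˡ [ x ] (IA-commuting !L y∈)

  ≈-cancelʳ : ∀ t {u u′} → u ++ t ≈ u′ ++ t → u ≈ u′
  ≈-cancelʳ [] {u} {u′} e = subst₂ _≈_ (++-identityʳ u) (++-identityʳ u′) e
  ≈-cancelʳ (x ∷ t) {u} {u′} e =
    cancel-last (≈-cancelʳ t (subst₂ _≈_ (≡.sym (++-assoc u [ x ] t)) (≡.sym (++-assoc u′ [ x ] t)) e))
    where
    found-inj : ∀ {r r′} → found r ≋ found r′ → r ≈ r′
    found-inj (found r≈) = r≈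
    cancel-last : u ++ [ x ] ≈ u′ ++ [ x ] → u ≈ u′
    cancel-last e′ = found-inj (subst₂ _≋_ (scan-snoc x u) (scan-snoc x u′) (scan-≈ x e′))

  factor : ∀ {w} L → AllPairs Commute L → (∀ {y} → y ∈ₗ L → IA G w y) → ∃ λ w′ → w ≈ w′ ++ L
  factor {w} [] _ _ = w , ≈-reflexive (≡.sym (++-identityʳ w))
  factor {w} (y ∷ L) (yL ∷ !L) IA⊇L with factor L !L (IA⊇L ∘ there)
  ... | w″ , w≈ with IA-++⁻ w″ (IA-resp-≈ (≈-sym w≈) (IA⊇L (here refl)))
  ...   | inj₁ yL-IA = ⊥-elim (proj₁ (All.lookup yL (IA⇒∈ yL-IA)) refl)
  ...   | inj₂ ((r , w″≈) , _) =
          r , ≈-trans w≈ (≈-trans (≈-++ʳ L w″≈) (≈-reflexive (++-assoc r [ y ] L)))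

  -- The decomposition of P_S(G) and the maps φ_K

  elems-commuting : ∀ {K} → Independent G K → AllPairs Commute (elems K)
  elems-commuting {K} K-ind =
    unique⇒allPairs (λ a∈ b∈ a≢b → a≢b , K-ind _ _ (to ∈-elems a∈) (to ∈-elems b∈)) (elems-unique K)

  N[]-or-commuting : ∀ K v → N[_] G K v ⊎ All (Commute v) (elems K)
  N[]-or-commuting K v with any? (λ y → (v ≟ y) ⊎-dec adj? G v y) (elems K)
  ... | yes hit = let y , y∈ , v≡y⊎v~y = find hit in inj₁ (y , to ∈-elems y∈ , v≡y⊎v~y)
  ... | no miss = inj₂ (All.map (λ ¬hit → ¬hit ∘ inj₁ , ¬hit ∘ inj₂) (¬Any⇒All¬ _ miss))

  P∅Pred-IA : ∀ {T w v} → P∅Pred G T w → IA G w v → T v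
  P∅Pred-IA (inj₁ refl) ia with () ← IA⇒∈ ia
  P∅Pred-IA (inj₂ (_ , IA⊆T)) ia = IA⊆T _ ia

  P∅Pred-intro : ∀ {T} w → (∀ v → IA G w v → T v) → P∅Pred G T w
  P∅Pred-intro [] _ = inj₁ refl
  P∅Pred-intro (_ ∷ _) IA⊆T = inj₂ ((λ ()) , IA⊆T)

  Pc-disjoint : ∀ {K K′ w} → K ≢ K′ → ¬ (Pc_ G K w × Pc_ G K′ w)
  Pc-disjoint K≢K′ ((_ , IA≡K) , (_ , IA≡K′)) =
    K≢K′ (⊆-antisym (to (IA≡K′ _) ∘ from (IA≡K _)) (to (IA≡K _) ∘ from (IA≡K′ _)))

  P⇔⋃Pc : ∀ {S} w →
    P_ G S w ⇔ Σ (Subset n) λ K → Nonempty K × Independent G K × K ⊆ S × Pc_ G K w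
  P⇔⋃Pc w = mk⇔
    (λ (w≢[] , IA⊆S) →
      let K = decSubset (IA? w) ; ∈K⇔ = ∈-decSubset (IA? w) ; v , ia = IA-nonempty w≢[] in
      K , (v , from ∈K⇔ ia) , (λ a b a∈ b∈ → IA-independent (to ∈K⇔ a∈) (to ∈K⇔ b∈)) ,
      IA⊆S _ ∘ to ∈K⇔ , w≢[] , λ _ → ⇔.sym ∈K⇔)
    (λ (K , _ , _ , K⊆S , w≢[] , IA≡K) → w≢[] , λ v → K⊆S ∘ to (IA≡K v))

  quotient-exists : ∀ {K w} → Independent G K → Pc_ G K w →
    Σ (Word G) λ w′ → w ≈ w′ ++ elems K × P∅Pred G (N[_] G K) w′
  quotient-exists {K} {w} K-ind (_ , IA≡K) with factor (elems K) (elems-commuting K-ind) (from (IA≡K _) ∘ to ∈-elems)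
  ... | w′ , w≈ = w′ , w≈ , P∅Pred-intro w′ IA⊆N[K]
    where
    IA⊆N[K] : ∀ v → IA G w′ v → N[_] G K v
    IA⊆N[K] v ia with N[]-or-commuting K v
    ... | inj₁ v∈N[K] = v∈N[K]
    ... | inj₂ vK = ⊥-elim (proj₁ (All.lookup vK (from ∈-elems v∈K)) refl)
      where
      v∈K : v ∈ K
      v∈K = to (IA≡K v) (IA-resp-≈ w≈ (IA-++-commuting ia vK))

  Pc-++-elems : ∀ {K w′} → Nonempty K → Independent G K → P∅Pred G (N[_] G K) w′ →
    Pc_ G K (w′ ++ elems K)
  Pc-++-elems {K} {w′} (x , x∈K) K-ind w′∈P∅ =
    nonempty , λ v → mk⇔ (IA⇒∈K v) (IA-++ˡ w′ ∘ IA-commuting (elems-commuting K-ind) ∘ from ∈-elems)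
    where
    nonempty : NonEmptyWord G (w′ ++ elems K)
    nonempty e with () ← ≡.subst (x ∈ₗ_) (++-conicalʳ w′ (elems K) e) (from ∈-elems x∈K)
    IA⇒∈K : ∀ v → IA G (w′ ++ elems K) v → v ∈ K
    IA⇒∈K v ia with IA-++⁻ w′ ia
    ... | inj₁ ia-K = to ∈-elems (IA⇒∈ ia-K)
    ... | inj₂ (ia-w′ , vK) with P∅Pred-IA w′∈P∅ ia-w′
    ...   | y , y∈K , inj₁ refl = y∈K
    ...   | y , y∈K , inj₂ v~y = ⊥-elim (proj₂ (All.lookup vK (from ∈-elems y∈K)) v~y)

lemma2p2 : ∀ {n : ℕ} (G : Graph n) (S : Subset n) →
    -- (1) pairwise disjointness of the P^c_K over distinct non-empty independent K ⊆ S
    ( (∀ (K K′ : Subset n) → Nonempty K → Independent G K → K ⊆ S →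
        Nonempty K′ → Independent G K′ → K′ ⊆ S → K ≢ K′ →
        ∀ w → ¬ (Pc_ G K w × Pc_ G K′ w))
    -- (1) their union is P_S(G)
    × (∀ w → P_ G S w ⇔
        Σ (Subset n) λ K → Nonempty K × Independent G K × K ⊆ S × Pc_ G K w) )
    ×
    -- (2) for every non-empty independent K ⊆ S, φ_K : w ↦ w / ∏_{y∈K} y
    ( ∀ (K : Subset n) → Nonempty K → Independent G K → K ⊆ S →
      -- well defined: the quotient exists and lies in P^∅_{N_G[K]}(G) ...
        (∀ w → Pc_ G K w →
           Σ (Word G) λ w′ → _≈w_ G w (w′ ++ elems K) × P∅Pred G (N[_] G K) w′)
      -- ... and is unique
      × (∀ w w₁ w₂ → Pc_ G K w → _≈w_ G w (w₁ ++ elems K) → _≈w_ G w (w₂ ++ elems K) →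
           _≈w_ G w₁ w₂)
      -- injective
      × (∀ w₁ w₂ w₁′ w₂′ → Pc_ G K w₁ → Pc_ G K w₂ →
           _≈w_ G w₁ (w₁′ ++ elems K) → _≈w_ G w₂ (w₂′ ++ elems K) →
           _≈w_ G w₁′ w₂′ → _≈w_ G w₁ w₂)
      -- surjective
      × (∀ w′ → P∅Pred G (N[_] G K) w′ →
           Σ (Word G) λ w → Pc_ G K w × _≈w_ G w (w′ ++ elems K)) )
lemma2p2 G S =
  ( (λ _ _ _ _ _ _ _ _ K≢K′ _ → Pc-disjoint G K≢K′) , P⇔⋃Pc G )
  , λ K K-nonempty K-ind _ →
      (λ _ → quotient-exists G K-ind)
    , (λ _ _ _ _ w≈₁ w≈₂ → ≈-cancelʳ G (elems K) (≈-trans G (≈-sym G w≈₁) w≈₂))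
    , (λ _ _ _ _ _ _ w≈₁ w≈₂ w′≈ → ≈-trans G w≈₁ (≈-trans G (≈-++ʳ G (elems K) w′≈) (≈-sym G w≈₂)))
    , λ w′ w′∈P∅ → w′ ++ elems K , Pc-++-elems G K-nonempty K-ind w′∈P∅ , ≈-refl G
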